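{- Let $A$ be a totally ordered alphabet, let $w$ be a nonempty finite word over $A$, and let $w=\ell_1\ell_2\cdots\ell_n$ be its factorization into Lyndon words with $\ell_1\ge\ell_2\ge\cdots\ge\ell_n$ (this factorization exists and is unique). Then: 1. $\ell_1$ is the shortest nonempty prefix $p$ of $w$ such that, writing $w=ps$, one has either $s$ empty or $p^\omega\ge s^\omega$; 2. $\ell_1$ is the shortest nonempty prefix $p$ of $w$ such that $p^\omega\ge w^\omega$.
   Context: The order $<$ on finite and infinite words is the lexicographical order induced by the order of $A$: $s<t$ if either $s$ is a proper prefix of $t$, or $s=pas'$, $t=pbt'$ with $p$ finite, $a,b$ letters with $a<b$. For a nonempty finite word $x$, $x^\omega=xxx\cdots$. A nonempty word $w$ is a Lyndon word if for every factorization $w=uv$ with $u,v$ nonempty one has $w<v$. -}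

module Defs where

open import Data.Nat using (ℕ; suc; _≤_) renaming (_<_ to _<ℕ_)
open import Data.Nat.DivMod using (_mod_)
open import Data.List using (List; []; _∷_; _++_; length; lookup)
open import Data.Product using (Σ; ∃; ∃₂; ∃-syntax; _×_)
open import Data.Sum using (_⊎_)
open import Relation.Binary.PropositionalEquality using (_≡_; _≢_)

module Words {A : Set} (_<_ : A → A → Set) where

  InfWord : Set
  InfWord = ℕ → A

  -- x^ω for the nonempty finite word x = a ∷ x'
  ω : A → List A → InfWord
  ω a x' i = lookup (a ∷ x') (i mod suc (length x'))

  _<ʷ_ : List A → List A → Set
  s <ʷ t = (∃₂ λ b t' → t ≡ s ++ (b ∷ t'))
         ⊎ (∃[ p ] ∃₂ λ a b → ∃₂ λ s' t' →
              s ≡ p ++ (a ∷ s') × t ≡ p ++ (b ∷ t') × a < b)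

  _≥ʷ_ : List A → List A → Set
  s ≥ʷ t = t <ʷ s ⊎ s ≡ t

  -- lexicographic order on infinite words (no proper prefixes occur)
  _<ᵢ_ : InfWord → InfWord → Set
  x <ᵢ y = ∃[ n ] ((∀ i → i <ℕ n → x i ≡ y i) × x n < y n)

  _≥ᵢ_ : InfWord → InfWord → Set
  x ≥ᵢ y = y <ᵢ x ⊎ (∀ i → x i ≡ y i)

  Lyndon : List A → Set
  Lyndon w = w ≢ [] × (∀ u v → u ≢ [] → v ≢ [] → w ≡ u ++ v → w <ʷ v)

  Cond1 : List A → List A → Set
  Cond1 w p = ∃[ a ] ∃[ p' ] ∃[ s ] (p ≡ a ∷ p' × w ≡ p ++ s ×
                (s ≡ [] ⊎ ∃₂ λ b s' → s ≡ b ∷ s' × ω a p' ≥ᵢ ω b s'))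

  Cond2 : List A → List A → Set
  Cond2 w p = ∃[ a ] ∃[ p' ] ∃[ s ] (p ≡ a ∷ p' × w ≡ p ++ s ×
                (∃₂ λ b w' → w ≡ b ∷ w' × ω a p' ≥ᵢ ω b w'))

  Shortest : (List A → List A → Set) → List A → List A → Set
  Shortest C w ℓ = C w ℓ × (∀ p → C w p → length ℓ ≤ length p)

{-# OPTIONS --safe #-}
module Submission where

-- Let ℓ = ℓ₁ and s = ℓ₂ ⋯ ℓₙ, so that every factor m satisfies m ≤ ℓ. A comparison
-- ℓ^ω < m y can be traded for ℓ^ω < y with an earlier first difference: for m = ℓ drop
-- a period; for a proper prefix m of ℓ = m v use ℓ < v (ℓ is Lyndon); any other m ≤ ℓ
-- would give m y < ℓ^ω. Hence ℓ^ω is never below a periodic word built from such factors,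
-- which gives ℓ^ω ≥ s^ω and ℓ^ω ≥ w^ω (two periodic words are compared on a common period).
-- Conversely, for a proper prefix p of ℓ = p u, the Lyndon property ℓ < u forces p^ω < u y
-- for every y, so p^ω is below both s'^ω (where w = p s') and w^ω.

open import Defs
open import Data.Empty using (⊥-elim)
open import Data.Fin using (toℕ; fromℕ<)
open import Data.Fin.Properties using (toℕ-injective; toℕ-fromℕ<)
open import Data.List using (List; []; _∷_; _++_; length; lookup; concat)
open import Data.List.Properties using (length-++; ++-conicalˡ; ∷-injective)
open import Data.List.Relation.Binary.Lex.Strict using (Lex-<; base; halt; this; next; <-transitive)
open import Data.List.Relation.Unary.All as All using (All; []; _∷_)
open import Data.List.Relation.Unary.Linked using (Linked)
open import Data.List.Relation.Unary.Linked.Properties using (Linked⇒All)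
open import Data.Nat using (ℕ; zero; suc; _+_; _∸_; _%_; NonZero; z≤n; s≤s; _<?_)
  renaming (_<_ to _<ℕ_; _≤_ to _≤ℕ_)
open import Data.Nat.DivMod using (_mod_; m%n<n; m%n%n≡m%n; m<n⇒m%n≡m; m∣n⇒o%n%m≡o%m; %-remove-+ˡ)
open import Data.Nat.Divisibility using (_∣_; ∣-refl; m∣m*n; n∣m*n)
open import Data.Nat.Induction using (<-rec)
open import Data.Nat.Properties
  using (<-cmp; ≤-refl; <⇒≤; <-trans; <-irrefl; ≤-<-trans; ≮⇒≥; m≤n+m; m<n+m; m<m+n;
         m≤n⇒m<n∨m≡n; m+[n∸m]≡n; ≤-pred; module ≤-Reasoning)
open import Data.Product using (∃; _×_; _,_; proj₁; proj₂)
open import Data.Sum using (inj₁; inj₂)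
open import Relation.Nullary using (¬_; yes; no)
open import Relation.Binary.Definitions using (Transitive; tri<; tri≈; tri>)
open import Relation.Binary.PropositionalEquality
  using (_≡_; _≢_; _≗_; refl; sym; trans; cong; subst; subst₂; module ≡-Reasoning)
open import Relation.Binary.Structures using (IsStrictTotalOrder)

module _ {A : Set} where

  infixr 5 _++ᵢ_
  _++ᵢ_ : List A → (ℕ → A) → (ℕ → A)
  ([] ++ᵢ x) i = x i
  ((a ∷ as) ++ᵢ x) zero = a
  ((a ∷ as) ++ᵢ x) (suc i) = (as ++ᵢ x) i

  ≗-sym : {x y : ℕ → A} → x ≗ y → y ≗ x
  ≗-sym x≗y i = sym (x≗y i)

  ≗-trans : {x y z : ℕ → A} → x ≗ y → y ≗ z → x ≗ z
  ≗-trans x≗y y≗z i = trans (x≗y i) (y≗z i)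

  ++ᵢ-congˡ : ∀ {as bs} x → as ≡ bs → as ++ᵢ x ≗ bs ++ᵢ x
  ++ᵢ-congˡ x refl i = refl

  ++ᵢ-congʳ : ∀ as {x y} → x ≗ y → as ++ᵢ x ≗ as ++ᵢ y
  ++ᵢ-congʳ [] x≗y i = x≗y i
  ++ᵢ-congʳ (a ∷ as) x≗y zero = refl
  ++ᵢ-congʳ (a ∷ as) x≗y (suc i) = ++ᵢ-congʳ as x≗y i

  ++ᵢ-assoc : ∀ as bs x → (as ++ bs) ++ᵢ x ≗ as ++ᵢ bs ++ᵢ x
  ++ᵢ-assoc [] bs x i = refl
  ++ᵢ-assoc (a ∷ as) bs x zero = refl
  ++ᵢ-assoc (a ∷ as) bs x (suc i) = ++ᵢ-assoc as bs x i

  ++ᵢ-drop : ∀ as x i → (as ++ᵢ x) (length as + i) ≡ x i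
  ++ᵢ-drop [] x i = refl
  ++ᵢ-drop (a ∷ as) x i = ++ᵢ-drop as x i

  ++ᵢ-lookup : ∀ as x {i} (i< : i <ℕ length as) → (as ++ᵢ x) i ≡ lookup as (fromℕ< i<)
  ++ᵢ-lookup (a ∷ as) x {zero} i< = refl
  ++ᵢ-lookup (a ∷ as) x {suc i} (s≤s i<) = ++ᵢ-lookup as x i<

  shorter-prefix-split : ∀ (ℓ p : List A) {s s′} → ℓ ++ s ≡ p ++ s′ → length p <ℕ length ℓ →
                         ∃ λ u → u ≢ [] × ℓ ≡ p ++ u × s′ ≡ u ++ s
  shorter-prefix-split (c ∷ ℓ) [] eq _ = c ∷ ℓ , (λ ()) , refl , sym eq
  shorter-prefix-split (c ∷ ℓ) (a ∷ p) eq (s≤s p<ℓ) with ∷-injective eq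
  ... | refl , eq′ with shorter-prefix-split ℓ p eq′ p<ℓ
  ...   | u , u≢[] , refl , s′≡us = u , u≢[] , refl , s′≡us

  ≢[]⇒0<length : ∀ {as : List A} → as ≢ [] → 0 <ℕ length as
  ≢[]⇒0<length {[]} as≢[] = ⊥-elim (as≢[] refl)
  ≢[]⇒0<length {_ ∷ _} _ = s≤s z≤n

  Periodic : (n : ℕ) .{{_ : NonZero n}} → (ℕ → A) → Set
  Periodic n x = ∀ i → x i ≡ x (i % n)

  module _ {n : ℕ} .{{_ : NonZero n}} {x : ℕ → A} (x-periodic : Periodic n x) where

    periodic-+ : ∀ i → x (n + i) ≡ x i
    periodic-+ i = begin
      x (n + i)       ≡⟨ x-periodic (n + i) ⟩
      x ((n + i) % n) ≡⟨ cong x (%-remove-+ˡ i ∣-refl) ⟩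
      x (i % n)       ≡⟨ sym (x-periodic i) ⟩
      x i             ∎
      where open ≡-Reasoning

    periodic-∣ : ∀ {m} .{{_ : NonZero m}} → n ∣ m → Periodic m x
    periodic-∣ {m} n∣m i = begin
      x i             ≡⟨ x-periodic i ⟩
      x (i % n)       ≡⟨ cong x (sym (m∣n⇒o%n%m≡o%m n m i n∣m)) ⟩
      x (i % m % n)   ≡⟨ sym (x-periodic (i % m)) ⟩
      x (i % m)       ∎
      where open ≡-Reasoning

    periodic-≗ : ∀ {y} → Periodic n y → (∀ i → i <ℕ n → x i ≡ y i) → x ≗ y
    periodic-≗ {y} y-periodic agree i =
      trans (x-periodic i) (trans (agree (i % n) (m%n<n i n)) (sym (y-periodic i)))

module _ {A : Set} (_<_ : A → A → Set) where
  open Words _<_ using (ω)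

  ω-periodic : ∀ a as → Periodic (suc (length as)) (ω a as)
  ω-periodic a as i = cong (lookup (a ∷ as)) (toℕ-injective (begin
    toℕ (i mod n)        ≡⟨ toℕ-fromℕ< _ ⟩
    i % n                ≡⟨ sym (m%n%n≡m%n i n) ⟩
    i % n % n            ≡⟨ sym (toℕ-fromℕ< _) ⟩
    toℕ ((i % n) mod n)  ∎))
    where
    n = suc (length as)
    open ≡-Reasoning

  ω-unfold : ∀ a as → ω a as ≗ (a ∷ as) ++ᵢ ω a as
  ω-unfold a as i with i <? suc (length as)
  ... | yes i<n = trans
          (cong (lookup (a ∷ as)) (toℕ-injective
            (trans (toℕ-fromℕ< _) (trans (m<n⇒m%n≡m i<n) (sym (toℕ-fromℕ< i<n))))))
          (sym (++ᵢ-lookup (a ∷ as) (ω a as) i<n))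
  ... | no i≮n = begin
      ω a as i                               ≡⟨ cong (ω a as) (sym i≡n+j) ⟩
      ω a as (n + j)                         ≡⟨ periodic-+ (ω-periodic a as) j ⟩
      ω a as j                               ≡⟨ sym (++ᵢ-drop (a ∷ as) (ω a as) j) ⟩
      ((a ∷ as) ++ᵢ ω a as) (n + j)          ≡⟨ cong ((a ∷ as) ++ᵢ ω a as) i≡n+j ⟩
      ((a ∷ as) ++ᵢ ω a as) i                ∎
    where
    n = suc (length as)
    j = i ∸ n
    i≡n+j : n + j ≡ i
    i≡n+j = m+[n∸m]≡n (≮⇒≥ i≮n)
    open ≡-Reasoning

  ω-unfold-≡ : ∀ {a as} ws → a ∷ as ≡ ws → ω a as ≗ ws ++ᵢ ω a as
  ω-unfold-≡ {a} {as} ws a∷as≡ws = ≗-trans (ω-unfold a as) (++ᵢ-congˡ (ω a as) a∷as≡ws)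

module _ {A : Set} {_<_ : A → A → Set} (sto : IsStrictTotalOrder _≡_ _<_) where
  open Words _<_
  open IsStrictTotalOrder sto using (compare; irrefl; isEquivalence; <-resp-≈)
    renaming (trans to <-trans′)

  -- Defs' x <ᵢ y is definitionally ∃ λ n → x <[ n ] y.
  infix 4 _<[_]_
  _<[_]_ : InfWord → ℕ → InfWord → Set
  x <[ n ] y = (∀ i → i <ℕ n → x i ≡ y i) × x n < y n

  <[]-resp : ∀ {x x′ y y′ n} → x ≗ x′ → y ≗ y′ → x <[ n ] y → x′ <[ n ] y′
  <[]-resp {n = n} x≗x′ y≗y′ (agree , x<y) =
    (λ i i<n → trans (sym (x≗x′ i)) (trans (agree i i<n) (y≗y′ i))) ,
    subst₂ _<_ (x≗x′ n) (y≗y′ n) x<y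

  <[]-irrefl : ∀ {x y n} → x ≗ y → ¬ x <[ n ] y
  <[]-irrefl {n = n} x≗y (_ , x<y) = irrefl (x≗y n) x<y

  <[]-asym : ∀ {x y j k} → x <[ j ] y → ¬ y <[ k ] x
  <[]-asym {j = j} {k} (agreeˣ , x<y) (agreeʸ , y<x) with <-cmp j k
  ... | tri< j<k _ _ = irrefl (sym (agreeʸ j j<k)) x<y
  ... | tri≈ _ refl _ = irrefl refl (<-trans′ x<y y<x)
  ... | tri> _ _ k<j = irrefl (sym (agreeˣ k k<j)) y<x

  <[]-position-unique : ∀ {x y j k} → x <[ j ] y → x <[ k ] y → j ≡ k
  <[]-position-unique {j = j} {k} (agreeʲ , x<yʲ) (agreeᵏ , x<yᵏ) with <-cmp j k
  ... | tri< j<k _ _ = ⊥-elim (irrefl (agreeᵏ j j<k) x<yʲ)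
  ... | tri≈ _ j≡k _ = j≡k
  ... | tri> _ _ k<j = ⊥-elim (irrefl (agreeʲ k k<j) x<yᵏ)

  <[]-trans : ∀ {x y z j k} → x <[ j ] y → y <[ k ] z → ∃ λ m → m ≤ℕ k × x <[ m ] z
  <[]-trans {x} {z = z} {j} {k} (agreeˣ , x<y) (agreeʸ , y<z) with <-cmp j k
  ... | tri< j<k _ _ = j , <⇒≤ j<k ,
        (λ i i<j → trans (agreeˣ i i<j) (agreeʸ i (<-trans i<j j<k))) ,
        subst (x j <_) (agreeʸ j j<k) x<y
  ... | tri≈ _ refl _ = k , ≤-refl ,
        (λ i i<k → trans (agreeˣ i i<k) (agreeʸ i i<k)) , <-trans′ x<y y<z
  ... | tri> _ _ k<j = k , ≤-refl ,
        (λ i i<k → trans (agreeˣ i (<-trans i<k k<j)) (agreeʸ i i<k)) ,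
        subst (_< z k) (sym (agreeˣ k k<j)) y<z

  <[]-prepend : ∀ as {x y n} → x <[ n ] y → as ++ᵢ x <[ length as + n ] as ++ᵢ y
  <[]-prepend [] x<y = x<y
  <[]-prepend (a ∷ as) x<y with <[]-prepend as x<y
  ... | agree , lt = (λ { zero _ → refl ; (suc i) (s≤s i<) → agree i i< }) , lt

  <[]-strip : ∀ as {x y n} → as ++ᵢ x <[ n ] as ++ᵢ y → ∃ λ n′ → n ≡ length as + n′ × x <[ n′ ] y
  <[]-strip [] {n = n} x<y = n , refl , x<y
  <[]-strip (a ∷ as) {n = zero} (_ , a<a) = ⊥-elim (irrefl refl a<a)
  <[]-strip (a ∷ as) {n = suc n} (agree , lt)
    with <[]-strip as ((λ i i< → agree (suc i) (s≤s i<)) , lt)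
  ... | n′ , refl , x<y = n′ , refl , x<y

  <[]-mismatch : ∀ q {a b s t} x y → a < b → (q ++ a ∷ s) ++ᵢ x <[ length q ] (q ++ b ∷ t) ++ᵢ y
  <[]-mismatch [] x y a<b = (λ i ()) , a<b
  <[]-mismatch (c ∷ q) x y a<b with <[]-mismatch q x y a<b
  ... | agree , lt = (λ { zero _ → refl ; (suc i) (s≤s i<) → agree i i< }) , lt

  data CompareBelow (n : ℕ) (x y : InfWord) : Set where
    less    : ∀ {e} → x <[ e ] y → CompareBelow n x y
    agree   : (∀ i → i <ℕ n → x i ≡ y i) → CompareBelow n x y
    greater : ∀ {e} → y <[ e ] x → CompareBelow n x y

  compare-below : ∀ n x y → CompareBelow n x y
  compare-below zero x y = agree (λ i ())
  compare-below (suc n) x y with compare-below n x y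
  ... | less x<y = less x<y
  ... | greater y<x = greater y<x
  ... | agree x≗y-below with compare (x n) (y n)
  ...   | tri< lt _ _ = less (x≗y-below , lt)
  ...   | tri> _ _ gt = greater ((λ i i< → sym (x≗y-below i i<)) , gt)
  ...   | tri≈ _ eq _ = agree agree′
    where
    agree′ : ∀ i → i <ℕ suc n → x i ≡ y i
    agree′ i i< with m≤n⇒m<n∨m≡n (≤-pred i<)
    ... | inj₁ i<n = x≗y-below i i<n
    ... | inj₂ refl = eq

  ≥ᵢ⇒≮ : ∀ {x y n} → x ≥ᵢ y → ¬ x <[ n ] y
  ≥ᵢ⇒≮ (inj₁ (_ , y<x)) x<y = <[]-asym x<y y<x
  ≥ᵢ⇒≮ (inj₂ x≗y) x<y = <[]-irrefl x≗y x<y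

  ≮⇒≥ᵢ : ∀ {n x y} .{{_ : NonZero n}} → Periodic n x → Periodic n y →
         (∀ k → ¬ x <[ k ] y) → x ≥ᵢ y
  ≮⇒≥ᵢ {n} {x} {y} x-periodic y-periodic x≮y with compare-below n x y
  ... | less x<y = ⊥-elim (x≮y _ x<y)
  ... | agree x≗y-below = inj₂ (periodic-≗ x-periodic y-periodic x≗y-below)
  ... | greater y<x = inj₁ (_ , y<x)

  ∷-<ʷ : ∀ {a s t} → s <ʷ t → (a ∷ s) <ʷ (a ∷ t)
  ∷-<ʷ (inj₁ (b , t′ , refl)) = inj₁ (b , t′ , refl)
  ∷-<ʷ {a} (inj₂ (p , b , c , s′ , t′ , refl , refl , b<c)) =
    inj₂ (a ∷ p , b , c , s′ , t′ , refl , refl , b<c)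

  <ʷ⇒Lex : ∀ {s t} → s <ʷ t → Lex-< _≡_ _<_ s t
  <ʷ⇒Lex {[]} (inj₁ (b , t′ , refl)) = halt
  <ʷ⇒Lex {a ∷ s} (inj₁ (b , t′ , refl)) = next refl (<ʷ⇒Lex (inj₁ (b , t′ , refl)))
  <ʷ⇒Lex (inj₂ ([] , a , b , s′ , t′ , refl , refl , a<b)) = this a<b
  <ʷ⇒Lex (inj₂ (c ∷ p , a , b , s′ , t′ , refl , refl , a<b)) =
    next refl (<ʷ⇒Lex (inj₂ (p , a , b , s′ , t′ , refl , refl , a<b)))

  Lex⇒<ʷ : ∀ {s t} → Lex-< _≡_ _<_ s t → s <ʷ t
  Lex⇒<ʷ (base ())
  Lex⇒<ʷ (halt {b} {t}) = inj₁ (b , t , refl)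
  Lex⇒<ʷ (this {a} {s} {b} {t} a<b) = inj₂ ([] , a , b , s , t , refl , refl , a<b)
  Lex⇒<ʷ (next refl s<t) = ∷-<ʷ (Lex⇒<ʷ s<t)

  ≥ʷ-trans : Transitive _≥ʷ_
  ≥ʷ-trans (inj₁ t<s) (inj₁ r<t) =
    inj₁ (Lex⇒<ʷ (<-transitive isEquivalence <-resp-≈ <-trans′ (<ʷ⇒Lex r<t) (<ʷ⇒Lex t<s)))
  ≥ʷ-trans (inj₁ t<s) (inj₂ refl) = inj₁ t<s
  ≥ʷ-trans (inj₂ refl) t≥r = t≥r

  lyndon-<-suffix : ∀ {ℓ} → Lyndon ℓ → ∀ m u → m ≢ [] → u ≢ [] → ℓ ≡ m ++ u →
                    ∃ λ d → ∀ x y → ℓ ++ᵢ x <[ d ] u ++ᵢ y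
  lyndon-<-suffix {ℓ} lyndon m u m≢[] u≢[] ℓ≡mu with proj₂ lyndon m u m≢[] u≢[] ℓ≡mu
  ... | inj₂ (q , a , b , s′ , t′ , refl , refl , a<b) = length q , λ x y → <[]-mismatch q x y a<b
  ... | inj₁ (b , t′ , u≡ℓbt) = ⊥-elim (<-irrefl refl (begin-strict
      length ℓ                        <⟨ m<m+n (length ℓ) (s≤s z≤n) ⟩
      length ℓ + suc (length t′)      ≡⟨ sym (length-++ ℓ) ⟩
      length (ℓ ++ b ∷ t′)            ≡⟨ cong length (sym u≡ℓbt) ⟩
      length u                        ≤⟨ m≤n+m (length u) (length m) ⟩
      length m + length u             ≡⟨ sym (length-++ m) ⟩
      length (m ++ u)                 ≡⟨ cong length (sym ℓ≡mu) ⟩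
      length ℓ                        ∎))
    where open ≤-Reasoning

  Below : List A → List A → Set
  Below ℓ m = m ≢ [] × ℓ ≥ʷ m

  factors-below-first : ∀ {ℓ ls} → All Lyndon (ℓ ∷ ls) → Linked _≥ʷ_ (ℓ ∷ ls) →
                        All (Below ℓ) (ℓ ∷ ls)
  factors-below-first lyndons linked =
    All.zip (All.map proj₁ lyndons , Linked⇒All ≥ʷ-trans (inj₂ refl) linked)

  module _ {c : A} {cs : List A} (lyndon : Lyndon (c ∷ cs)) where

    ω<-skip : ∀ {m y N} → Below (c ∷ cs) m → ω c cs <[ N ] m ++ᵢ y →
              ∃ λ N′ → N′ <ℕ N × ω c cs <[ N′ ] y
    ω<-skip (_ , inj₂ refl) L<my
      with <[]-strip (c ∷ cs) (<[]-resp (ω-unfold _<_ c cs) (λ _ → refl) L<my)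
    ... | N′ , refl , L<y = N′ , m<n+m N′ (s≤s z≤n) , L<y
    ω<-skip {m} {y} (m≢[] , inj₁ (inj₁ (b , t , ℓ≡mbt))) L<my
      with <[]-strip m (<[]-resp L≗m[bt]L (λ _ → refl) L<my)
      where
      L≗m[bt]L : ω c cs ≗ m ++ᵢ (b ∷ t) ++ᵢ ω c cs
      L≗m[bt]L = ≗-trans (ω-unfold-≡ _<_ (m ++ b ∷ t) ℓ≡mbt) (++ᵢ-assoc m (b ∷ t) (ω c cs))
    ... | N′ , refl , btL<y with lyndon-<-suffix lyndon m (b ∷ t) m≢[] (λ ()) ℓ≡mbt
    ...   | d , ℓ<bt
      with <[]-trans (<[]-resp (≗-sym (ω-unfold _<_ c cs)) (λ _ → refl) (ℓ<bt _ _)) btL<y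
    ...     | k , k≤N′ , L<y = k , ≤-<-trans k≤N′ (m<n+m N′ (≢[]⇒0<length m≢[])) , L<y
    ω<-skip {y = y} (_ , inj₁ (inj₂ (q , a , b , s , t , refl , ℓ≡qbt , a<b))) L<my =
      ⊥-elim (<[]-asym L<my (<[]-resp (λ _ → refl) (≗-sym (ω-unfold-≡ _<_ _ ℓ≡qbt))
                                       (<[]-mismatch q y (ω c cs) a<b)))

    ω≮-cycle : ∀ {x m ms} → All (Below (c ∷ cs)) (m ∷ ms) → x ≗ concat (m ∷ ms) ++ᵢ x →
               ∀ N → ¬ ω c cs <[ N ] x
    ω≮-cycle {x} {m} {ms} below x-cycle N = <-rec P descend N [] []
      where
      P : ℕ → Set
      P N = ∀ r → All (Below (c ∷ cs)) r → ¬ ω c cs <[ N ] concat r ++ᵢ x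
      skip-first : ∀ {N} → (∀ {N′} → N′ <ℕ N → P N′) → ∀ r₀ r → All (Below (c ∷ cs)) (r₀ ∷ r) →
                   ¬ ω c cs <[ N ] concat (r₀ ∷ r) ++ᵢ x
      skip-first ih r₀ r (b ∷ bs) L<rx
        with ω<-skip b (<[]-resp (λ _ → refl) (++ᵢ-assoc r₀ (concat r) x) L<rx)
      ... | N′ , N′<N , L<r′x = ih N′<N r bs L<r′x
      descend : ∀ N → (∀ {N′} → N′ <ℕ N → P N′) → P N
      descend N ih [] [] L<x = skip-first ih m ms below (<[]-resp (λ _ → refl) x-cycle L<x)
      descend N ih (r₀ ∷ r) bs L<rx = skip-first ih r₀ r bs L<rx

    ω≥-concat : ∀ {b s} ms → All (Below (c ∷ cs)) ms → concat ms ≡ b ∷ s → ω c cs ≥ᵢ ω b s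
    ω≥-concat [] _ ()
    ω≥-concat {b} {s} (m ∷ ms) below concat≡ = ≮⇒≥ᵢ
      (periodic-∣ (ω-periodic _<_ c cs) (m∣m*n (suc (length s))))
      (periodic-∣ (ω-periodic _<_ b s) (n∣m*n (suc (length cs))))
      (ω≮-cycle below (ω-unfold-≡ _<_ (concat (m ∷ ms)) (sym concat≡)))

    ω<-of-proper-prefix : ∀ {a p u} → c ∷ cs ≡ (a ∷ p) ++ u → u ≢ [] →
                          ∀ y → ∃ λ k → ω a p <[ k ] u ++ᵢ y
    ω<-of-proper-prefix {a} {p} {u} ℓ≡pu u≢[] y =
      from-comparison (compare-below (suc (length (a ∷ p) + d)) P ((c ∷ cs) ++ᵢ y))
      where
      P = ω a p
      ℓ<u = lyndon-<-suffix lyndon (a ∷ p) u (λ ()) u≢[] ℓ≡pu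
      d = proj₁ ℓ<u
      ℓy<uy : (c ∷ cs) ++ᵢ y <[ d ] u ++ᵢ y
      ℓy<uy = proj₂ ℓ<u y y
      ℓy≗puy : (c ∷ cs) ++ᵢ y ≗ (a ∷ p) ++ᵢ u ++ᵢ y
      ℓy≗puy = ≗-trans (++ᵢ-congˡ y ℓ≡pu) (++ᵢ-assoc (a ∷ p) u y)
      open ≡-Reasoning

      from-comparison : CompareBelow (suc (length (a ∷ p) + d)) P ((c ∷ cs) ++ᵢ y) →
                        ∃ λ k → P <[ k ] u ++ᵢ y
      from-comparison (less P<ℓy) with <[]-trans P<ℓy ℓy<uy
      ... | k , _ , P<uy = k , P<uy
      from-comparison (greater ℓy<P)
        with <[]-strip (a ∷ p) (<[]-resp ℓy≗puy (ω-unfold _<_ a p) ℓy<P)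
      ... | e′ , refl , uy<P with <[]-trans ℓy<uy uy<P
      ...   | k , k≤e′ , ℓy<ᵏP = ⊥-elim (<-irrefl (<[]-position-unique ℓy<ᵏP ℓy<P)
                                            (≤-<-trans k≤e′ (m<n+m e′ (s≤s z≤n))))
      from-comparison (agree P≗ℓy-below) = ⊥-elim (irrefl (sym (begin
        (u ++ᵢ y) d                                ≡⟨ ++ᵢ-drop (a ∷ p) (u ++ᵢ y) d ⟨
        ((a ∷ p) ++ᵢ u ++ᵢ y) (length (a ∷ p) + d) ≡⟨ ℓy≗puy (length (a ∷ p) + d) ⟨
        ((c ∷ cs) ++ᵢ y) (length (a ∷ p) + d)      ≡⟨ P≗ℓy-below (length (a ∷ p) + d) ≤-refl ⟨
        P (length (a ∷ p) + d)                     ≡⟨ periodic-+ (ω-periodic _<_ a p) d ⟩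
        P d                                        ≡⟨ P≗ℓy-below d (s≤s (m≤n+m d (length (a ∷ p)))) ⟩
        ((c ∷ cs) ++ᵢ y) d                         ∎)) (proj₂ ℓy<uy))

    shortest-cond₁ : ∀ ls → All (Below (c ∷ cs)) ls →
                     Shortest Cond1 ((c ∷ cs) ++ concat ls) (c ∷ cs)
    shortest-cond₁ ls below = cond₁ , λ p cond → ≮⇒≥ (minimal cond)
      where
      cond₁ : Cond1 ((c ∷ cs) ++ concat ls) (c ∷ cs)
      cond₁ with concat ls in concat≡
      ... | [] = c , cs , [] , refl , refl , inj₁ refl
      ... | b ∷ s =
        c , cs , b ∷ s , refl , refl , inj₂ (b , s , refl , ω≥-concat ls below concat≡)
      minimal : ∀ {p} → Cond1 ((c ∷ cs) ++ concat ls) p → ¬ length p <ℕ length (c ∷ cs)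
      minimal (a , p , s′ , refl , w≡ps′ , s′-cases) p<ℓ
        with shorter-prefix-split (c ∷ cs) (a ∷ p) w≡ps′ p<ℓ
      ... | u , u≢[] , ℓ≡pu , s′≡us with s′-cases
      ...   | inj₁ s′≡[] = u≢[] (++-conicalˡ u (concat ls) (trans (sym s′≡us) s′≡[]))
      ...   | inj₂ (b , t , s′≡bt , P≥T)
        with ω<-of-proper-prefix ℓ≡pu u≢[] (concat ls ++ᵢ ω b t)
      ...     | k , P<usT = ≥ᵢ⇒≮ P≥T (<[]-resp (λ _ → refl) (≗-sym T≗usT) P<usT)
        where
        T≗usT : ω b t ≗ u ++ᵢ concat ls ++ᵢ ω b t
        T≗usT = ≗-trans (ω-unfold-≡ _<_ (u ++ concat ls) (trans (sym s′≡bt) s′≡us))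
                        (++ᵢ-assoc u (concat ls) (ω b t))

    shortest-cond₂ : ∀ ls → All (Below (c ∷ cs)) ls →
                     Shortest Cond2 ((c ∷ cs) ++ concat ls) (c ∷ cs)
    shortest-cond₂ ls below = cond₂ , λ p cond → ≮⇒≥ (minimal cond)
      where
      cond₂ : Cond2 ((c ∷ cs) ++ concat ls) (c ∷ cs)
      cond₂ = c , cs , concat ls , refl , refl , c , cs ++ concat ls , refl ,
              ω≥-concat ((c ∷ cs) ∷ ls) (((λ ()) , inj₂ refl) ∷ below) refl
      minimal : ∀ {p} → Cond2 ((c ∷ cs) ++ concat ls) p → ¬ length p <ℕ length (c ∷ cs)
      minimal (a , p , s′ , refl , w≡ps′ , b , t , w≡bt , P≥W) p<ℓ
        with shorter-prefix-split (c ∷ cs) (a ∷ p) w≡ps′ p<ℓ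
      ... | u , u≢[] , ℓ≡pu , s′≡us with ω<-of-proper-prefix ℓ≡pu u≢[] (concat ls ++ᵢ ω b t)
      ...   | k , P<usW =
              ≥ᵢ⇒≮ P≥W (<[]-resp (≗-sym (ω-unfold _<_ a p)) (≗-sym W≗pusW)
                                 (<[]-prepend (a ∷ p) P<usW))
        where
        W≗pusW : ω b t ≗ (a ∷ p) ++ᵢ u ++ᵢ concat ls ++ᵢ ω b t
        W≗pusW = ≗-trans (ω-unfold-≡ _<_ ((a ∷ p) ++ u ++ concat ls)
                                        (trans (sym w≡bt) (trans w≡ps′ (cong ((a ∷ p) ++_) s′≡us))))
                 (≗-trans (++ᵢ-assoc (a ∷ p) (u ++ concat ls) (ω b t))
                          (++ᵢ-congʳ (a ∷ p) (++ᵢ-assoc u (concat ls) (ω b t))))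

theorem6 : {A : Set} (_<_ : A → A → Set) → IsStrictTotalOrder _≡_ _<_ →
    (w : List A) → w ≢ [] →
    (ℓ₁ : List A) (ls : List (List A)) →
    All (Words.Lyndon _<_) (ℓ₁ ∷ ls) →
    Linked (Words._≥ʷ_ _<_) (ℓ₁ ∷ ls) →
    concat (ℓ₁ ∷ ls) ≡ w →
    Words.Shortest _<_ (Words.Cond1 _<_) w ℓ₁ × Words.Shortest _<_ (Words.Cond2 _<_) w ℓ₁
theorem6 _<_ sto w w≢[] [] ls (lyndon ∷ _) _ _ = ⊥-elim (proj₁ lyndon refl)
theorem6 _<_ sto w w≢[] (c ∷ cs) ls lyndons@(lyndon ∷ _) linked refl
  with factors-below-first sto lyndons linked
... | _ ∷ below = shortest-cond₁ sto lyndon ls below , shortest-cond₂ sto lyndon ls below
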